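{- Let $F\subseteq S\subseteq T$ be trees, where $F$ is uniquely $3$-$\chi_\rho$-packable, and let $c:V(T)\to\{1,2,3\}$ be any packing colouring of $T$. Then for every vertex $u\in V(S)$ and every packing colouring $c':V(S)\to\{1,2,3\}$ of $S$, we have $c'(u)=3$ if and only if $c(u)=3$.
   Context: A set $X\subseteq V(G)$ is an $i$-packing if distinct vertices of $X$ are at distance $>i$. A packing colouring with colours $\{1,\ldots,k\}$ is a map $c:V(G)\to\{1,\ldots,k\}$ with each class $c^{ -1}(i)$ an $i$-packing; $\chi_\rho(G)$ is the least such $k$. $G$ is uniquely $k$-$\chi_\rho$-packable if $\chi_\rho(G)=k$ and there is exactly one packing colouring $V(G)\to\{1,\ldots,k\}$ (colourings compared as functions, not up to permutation of colours). -}

module Defs where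

open import Data.Nat using (ℕ; zero; suc; _≤_; _<_)
open import Data.Fin using (Fin)
open import Data.List using (List; []; _∷_; length; _∷ʳ_)
open import Data.List.Relation.Unary.Linked using (Linked)
open import Data.List.Relation.Unary.Unique.Propositional using (Unique)
open import Data.Product using (Σ; ∃; _×_)
open import Data.Empty using (⊥)
open import Relation.Nullary using (¬_)
open import Relation.Binary.PropositionalEquality using (_≡_; _≢_)

-- A finite simple graph whose vertex set is a subset of the labelled
-- universe Fin n (so that subgraphs of a common graph share vertex names).
record Graph (n : ℕ) : Set₁ where
  field
    V     : Fin n → Set
    E     : Fin n → Fin n → Set
    E-sym : ∀ {u v} → E u v → E v u
    E-irr : ∀ {u} → ¬ E u u
    E-V   : ∀ {u v} → E u v → V u × V v
open Graph public

_⊆G_ : ∀ {n} → Graph n → Graph n → Set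
H ⊆G G = (∀ v → V H v → V G v) × (∀ u v → E H u v → E G u v)

data Walk {n} (H : Graph n) : Fin n → Fin n → ℕ → Set where
  nil  : ∀ {u} → V H u → Walk H u u 0
  cons : ∀ {u w v ℓ} → E H u w → Walk H w v ℓ → Walk H u v (suc ℓ)

Connected : ∀ {n} → Graph n → Set
Connected H = ∀ u v → V H u → V H v → ∃ λ ℓ → Walk H u v ℓ

IsCycle : ∀ {n} → Graph n → Fin n → List (Fin n) → Set
IsCycle H x ys = (2 ≤ length ys) × Unique (x ∷ ys) × Linked (E H) ((x ∷ ys) ∷ʳ x)

Acyclic : ∀ {n} → Graph n → Set
Acyclic H = ∀ x ys → ¬ IsCycle H x ys

Tree : ∀ {n} → Graph n → Set
Tree H = (∃ λ v → V H v) × Connected H × Acyclic H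

DistLe : ∀ {n} → Graph n → Fin n → Fin n → ℕ → Set
DistLe H u v ℓ = ∃ λ m → m ≤ ℓ × Walk H u v m

-- c is a packing colouring of H with colours {1,…,k}; only the values of c
-- on V(H) are relevant.  Each colour class c⁻¹(i) is an i-packing:
-- distinct vertices of colour i are at distance > i.
PackingColouring : ∀ {n} → Graph n → ℕ → (Fin n → ℕ) → Set
PackingColouring H k c =
  (∀ v → V H v → 1 ≤ c v × c v ≤ k) ×
  (∀ u v → V H u → V H v → u ≢ v → c u ≡ c v → ¬ DistLe H u v (c u))

PackingChromatic : ∀ {n} → Graph n → ℕ → Set
PackingChromatic {n} H k =
  (Σ (Fin n → ℕ) λ c → PackingColouring H k c) ×
  (∀ j → j < k → ∀ c → ¬ PackingColouring H j c)

UniquelyPackable : ∀ {n} → Graph n → ℕ → Set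
UniquelyPackable {n} H k =
  PackingChromatic H k ×
  (∀ c c' → PackingColouring H k c → PackingColouring H k c' →
     ∀ v → V H v → c v ≡ c' v)

{-# OPTIONS --safe #-}
-- In a packing 3-colouring, a vertex of colour 3 forces the colours 3, 1, 2, 1, 3 along
-- any walk whose vertices two or three steps apart are distinct; hence, along such a walk
-- starting at colour 3, colour 3 occurs exactly at the positions divisible by 4. Every
-- packing 3-colouring of F uses colour 3 at some x (otherwise it would be a packing
-- 2-colouring), and by uniqueness c and c' agree at x. Every walk in S from x to u can be
-- shortened to one of the above kind, of some length ℓ, and then c(u) = 3 ⇔ 4 ∣ ℓ ⇔ c'(u) = 3.
module Submission where

open import Defs
open import Data.Nat using (ℕ; suc; _≤_; _+_; z≤n; s≤s; z<s; s<s)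
open import Data.Nat.Properties using (≤-refl; _≟_; ≤∧≢⇒<; ≤-pred)
open import Data.Nat.Divisibility using (_∣_; _∣0; ∣-refl; ∣m∣n⇒∣m+n; ∣m+n∣m⇒∣n; >⇒∤)
open import Data.Fin using (Fin)
import Data.Fin.Properties as Finₚ
open import Data.Product using (Σ; ∃; _×_; _,_; proj₁; proj₂)
open import Data.Sum using (_⊎_; inj₁; inj₂)
open import Data.Unit using (⊤; tt)
open import Data.Empty using (⊥; ⊥-elim)
open import Function.Bundles using (_⇔_; mk⇔; Equivalence)
import Function.Properties.Equivalence as ⇔
open import Relation.Nullary using (¬_; Dec; yes; no)
open import Relation.Nullary.Decidable using (decidable-stable)
open import Relation.Nullary.Negation using (¬¬-map)
open import Relation.Binary.PropositionalEquality using (_≡_; _≢_; refl; sym; trans; subst)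

⇔-stable : ∀ {A B : Set} → Dec A → Dec B → ¬ ¬ (A ⇔ B) → A ⇔ B
⇔-stable a? b? ¬¬A⇔B = mk⇔
  (λ a → decidable-stable b? (¬¬-map (λ A⇔B → Equivalence.to A⇔B a) ¬¬A⇔B))
  (λ b → decidable-stable a? (¬¬-map (λ A⇔B → Equivalence.from A⇔B b) ¬¬A⇔B))

both-false : ∀ {A B : Set} → ¬ A → ¬ B → A ⇔ B
both-false ¬a ¬b = mk⇔ (λ a → ⊥-elim (¬a a)) (λ b → ⊥-elim (¬b b))

∣⇔∣+self : ∀ {d m} → d ∣ m ⇔ d ∣ d + m
∣⇔∣+self = mk⇔ (∣m∣n⇒∣m+n ∣-refl) (λ d∣d+m → ∣m+n∣m⇒∣n d∣d+m ∣-refl)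

Walk-⊆ : ∀ {n} {H G : Graph n} → H ⊆G G → ∀ {u v m} → Walk H u v m → Walk G u v m
Walk-⊆ H⊆G (nil u∈H)  = nil (proj₁ H⊆G _ u∈H)
Walk-⊆ H⊆G (cons e w) = cons (proj₂ H⊆G _ _ e) (Walk-⊆ H⊆G w)

packingColouring-⊆ : ∀ {n} {H G : Graph n} {k c} → H ⊆G G →
  PackingColouring G k c → PackingColouring H k c
packingColouring-⊆ H⊆G (range , packing) =
  (λ v v∈H → range v (proj₁ H⊆G v v∈H)) ,
  (λ u v u∈H v∈H u≢v same (m , m≤ , w) →
    packing u v (proj₁ H⊆G u u∈H) (proj₁ H⊆G v v∈H) u≢v same (m , m≤ , Walk-⊆ H⊆G w))

packingChromatic-uses-top : ∀ {n} {H : Graph n} {k c} → PackingChromatic H (suc k) →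
  PackingColouring H (suc k) c → ¬ ¬ (∃ λ x → V H x × c x ≡ suc k)
packingChromatic-uses-top {H = H} {k} {c} (_ , minimal) (range , packing) unused =
  minimal k ≤-refl c ((λ v v∈H → proj₁ (range v v∈H) , below-top v v∈H) , packing)
  where
  below-top : ∀ v → V H v → c v ≤ k
  below-top v v∈H = ≤-pred (≤∧≢⇒< (proj₂ (range v v∈H)) (λ top → unused (v , v∈H , top)))

module _ {n : ℕ} (G : Graph n) where

  Walk-start : ∀ {a v ℓ} → Walk G a v ℓ → V G a
  Walk-start (nil a∈G)  = a∈G
  Walk-start (cons e _) = proj₁ (E-V G e)

  Walk-end : ∀ {a v ℓ} → Walk G a v ℓ → V G v
  Walk-end (nil v∈G) = v∈G
  Walk-end (cons _ w) = Walk-end w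

  _≢₁_ : ∀ {b v ℓ} → Fin n → Walk G b v ℓ → Set
  a ≢₁ nil _            = ⊤
  a ≢₁ cons {w = c} _ _ = a ≢ c

  _≢₂_ : ∀ {b v ℓ} → Fin n → Walk G b v ℓ → Set
  a ≢₂ nil _    = ⊤
  a ≢₂ cons _ w = a ≢₁ w

  Straight : ∀ {a v ℓ} → Walk G a v ℓ → Set
  Straight (nil _)            = ⊤
  Straight (cons {u = a} _ w) = a ≢₁ w × a ≢₂ w × Straight w

  StraightWalk : Fin n → Fin n → Set
  StraightWalk a v = Σ ℕ λ ℓ → Σ (Walk G a v ℓ) Straight

  -- Prepending an edge, cutting off the closed walk of length 2 or 3 it may create.
  cons-straight : ∀ {a b v ℓ} → E G a b → (w : Walk G b v ℓ) → Straight w → StraightWalk a v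
  cons-straight ab (nil b∈G) _ = _ , cons ab (nil b∈G) , tt , tt , tt
  cons-straight {a} ab (cons {w = c} bc w) sw with a Finₚ.≟ c
  ... | yes refl = _ , w , proj₂ (proj₂ sw)
  cons-straight {a} ab (cons {w = c} bc (nil c∈G)) sw | no a≢c =
    _ , cons ab (cons bc (nil c∈G)) , a≢c , tt , sw
  cons-straight {a} ab (cons {w = c} bc (cons {w = e} ce w)) sw | no a≢c with a Finₚ.≟ e
  ... | yes refl = _ , w , proj₂ (proj₂ (proj₂ (proj₂ sw)))
  ... | no a≢e   = _ , cons ab (cons bc (cons ce w)) , a≢c , a≢e , sw

  straighten : ∀ {a v ℓ} → Walk G a v ℓ → StraightWalk a v
  straighten (nil v∈G) = _ , nil v∈G , tt
  straighten (cons e w) with straighten w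
  ... | _ , w′ , sw′ = cons-straight e w′ sw′

  module _ {d : Fin n → ℕ} (P : PackingColouring G 3 d) where

    packing-separates : ∀ {x y m} → x ≢ y → d x ≡ d y → Walk G x y m → m ≤ d x → ⊥
    packing-separates x≢y same w m≤ = proj₂ P _ _ (Walk-start w) (Walk-end w) x≢y same (_ , m≤ , w)

    colour-cases : ∀ {v} → V G v → d v ≡ 1 ⊎ d v ≡ 2 ⊎ d v ≡ 3
    colour-cases {v} v∈G = cases (d v) (proj₁ P v v∈G)
      where
      cases : ∀ k → 1 ≤ k × k ≤ 3 → k ≡ 1 ⊎ k ≡ 2 ⊎ k ≡ 3
      cases 1 _ = inj₁ refl
      cases 2 _ = inj₂ (inj₁ refl)
      cases 3 _ = inj₂ (inj₂ refl)
      cases 0 (() , _)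
      cases (suc (suc (suc (suc _)))) (_ , s≤s (s≤s (s≤s ())))

    adjacent-distinct : ∀ {x y} → E G x y → x ≢ y
    adjacent-distinct xy refl = E-irr G xy

    adjacent-colours-differ : ∀ {x y} → E G x y → d x ≢ d y
    adjacent-colours-differ xy same = packing-separates (adjacent-distinct xy) same
      (cons xy (nil (proj₂ (E-V G xy)))) (proj₁ (proj₁ P _ (proj₁ (E-V G xy))))

    colour-2-at-distance-2 : ∀ {x y z} → x ≢ z → E G x y → E G y z → d x ≡ 2 → d z ≢ 2
    colour-2-at-distance-2 x≢z xy yz dx dz = packing-separates x≢z (trans dx (sym dz))
      (cons xy (cons yz (nil (proj₂ (E-V G yz))))) (subst (2 ≤_) (sym dx) ≤-refl)

    colour-3-within-distance-3 : ∀ {x y m} → d x ≡ 3 → x ≢ y → Walk G x y m → m ≤ 3 → d y ≢ 3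
    colour-3-within-distance-3 dx x≢y w m≤3 dy =
      packing-separates x≢y (trans dx (sym dy)) w (subst (_ ≤_) (sym dx) m≤3)

    colour-3-four-steps-on : ∀ {a b c e g} → d a ≡ 3 →
      E G a b → E G b c → E G c e → E G e g →
      a ≢ c → a ≢ e → b ≢ e → c ≢ g → d g ≡ 3
    colour-3-four-steps-on da ab bc ce eg a≢c a≢e b≢e c≢g = g-is-3 (colour-cases (proj₂ (E-V G eg)))
      where
      b-walk = cons ab (nil (proj₂ (E-V G ab)))
      c-walk = cons ab (cons bc (nil (proj₂ (E-V G bc))))
      e-walk = cons ab (cons bc (cons ce (nil (proj₂ (E-V G ce)))))

      colour-1-or-2 : ∀ {y m} → Walk G _ y m → _ ≢ y → m ≤ 3 → d y ≡ 1 ⊎ d y ≡ 2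
      colour-1-or-2 w a≢y m≤3 with colour-cases (Walk-end w)
      ... | inj₁ p         = inj₁ p
      ... | inj₂ (inj₁ p)  = inj₂ p
      ... | inj₂ (inj₂ p)  = ⊥-elim (colour-3-within-distance-3 da a≢y w m≤3 p)

      c≡2 : d _ ≡ 2
      c≡2 with colour-1-or-2 b-walk (adjacent-distinct ab) (s≤s z≤n)
             | colour-1-or-2 c-walk a≢c (s≤s (s≤s z≤n))
             | colour-1-or-2 e-walk a≢e ≤-refl
      ... | _      | inj₂ q | _      = q
      ... | inj₁ p | inj₁ q | _      = ⊥-elim (adjacent-colours-differ bc (trans p (sym q)))
      ... | _      | inj₁ q | inj₁ r = ⊥-elim (adjacent-colours-differ ce (trans q (sym r)))
      ... | inj₂ p | inj₁ _ | inj₂ r = ⊥-elim (colour-2-at-distance-2 b≢e bc ce p r)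

      e≡1 : d _ ≡ 1
      e≡1 with colour-1-or-2 e-walk a≢e ≤-refl
      ... | inj₁ r = r
      ... | inj₂ r = ⊥-elim (adjacent-colours-differ ce (trans c≡2 (sym r)))

      g-is-3 : d _ ≡ 1 ⊎ d _ ≡ 2 ⊎ d _ ≡ 3 → d _ ≡ 3
      g-is-3 (inj₁ s)         = ⊥-elim (adjacent-colours-differ eg (trans e≡1 (sym s)))
      g-is-3 (inj₂ (inj₁ s))  = ⊥-elim (colour-2-at-distance-2 c≢g ce eg c≡2 s)
      g-is-3 (inj₂ (inj₂ s))  = s

    colour-3⇔4∣length : ∀ {a v ℓ} (w : Walk G a v ℓ) → Straight w → d a ≡ 3 → (d v ≡ 3 ⇔ 4 ∣ ℓ)
    colour-3⇔4∣length (nil _) _ da = mk⇔ (λ _ → 4 ∣0) (λ _ → da)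
    colour-3⇔4∣length w@(cons ab (nil _)) _ da =
      both-false (colour-3-within-distance-3 da (adjacent-distinct ab) w (s≤s z≤n)) (>⇒∤ (s<s z<s))
    colour-3⇔4∣length w@(cons _ (cons _ (nil _))) (a≢c , _) da =
      both-false (colour-3-within-distance-3 da a≢c w (s≤s (s≤s z≤n))) (>⇒∤ (s<s (s<s z<s)))
    colour-3⇔4∣length w@(cons _ (cons _ (cons _ (nil _)))) (_ , a≢e , _) da =
      both-false (colour-3-within-distance-3 da a≢e w ≤-refl) (>⇒∤ (s<s (s<s (s<s z<s))))
    colour-3⇔4∣length (cons ab (cons bc (cons ce (cons eg w))))
                       (a≢c , a≢e , b≢e , _ , c≢g , _ , _ , _ , sw) da =
      ⇔.trans (colour-3⇔4∣length w sw (colour-3-four-steps-on da ab bc ce eg a≢c a≢e b≢e c≢g))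
              ∣⇔∣+self

lemma2p6 : ∀ n (F S T : Graph n) → Tree F → Tree S → Tree T →
    F ⊆G S → S ⊆G T → UniquelyPackable F 3 →
    (c : Fin n → ℕ) → PackingColouring T 3 c →
    ∀ u → V S u → (c' : Fin n → ℕ) → PackingColouring S 3 c' →
    (c' u ≡ 3 ⇔ c u ≡ 3)
lemma2p6 n F S T _ (_ , S-connected , _) _ F⊆S S⊆T (χF≡3 , unique) c c-packs u u∈S c' c'-packs =
  ⇔-stable (c' u ≟ 3) (c u ≟ 3) (¬¬-map agree-from (packingChromatic-uses-top χF≡3 c-on-F))
  where
  c-on-S : PackingColouring S 3 c
  c-on-S = packingColouring-⊆ S⊆T c-packs

  c-on-F : PackingColouring F 3 c
  c-on-F = packingColouring-⊆ F⊆S c-on-S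

  agree-from : (∃ λ x → V F x × c x ≡ 3) → c' u ≡ 3 ⇔ c u ≡ 3
  agree-from (x , x∈F , cx≡3)
    with straighten S (proj₂ (S-connected x u (proj₁ F⊆S x x∈F) u∈S))
  ... | _ , w , sw = ⇔.trans (colour-3⇔4∣length S c'-packs w sw c'x≡3)
                             (⇔.sym (colour-3⇔4∣length S c-on-S w sw cx≡3))
    where
    c'x≡3 : c' x ≡ 3
    c'x≡3 = trans (sym (unique c c' c-on-F (packingColouring-⊆ F⊆S c'-packs) x x∈F)) cx≡3
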